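{- Let $(G,k)$ be an instance of Vertex Cover, let $v\in V(G)$ and $S\subseteq V(G)$. Let $G'$ be obtained from $G$ by creating a new vertex $u$ and adding all edges between $u$ and the vertices of $S\cup N[v]$. Then $(G,k)$ and $(G',k+1)$ are equivalent.
   Context: Vertex Cover: given an undirected simple graph $G=(V,E)$ and an integer $k$, decide whether there is $S\subseteq V$ with $|S|\le k$ such that every edge has an endpoint in $S$. Two instances are equivalent if both are yes-instances or both are no-instances. $N[v]$ is the closed neighborhood of $v$. -}

module Defs where

open import Data.Nat using (ℕ; suc; _≤_)
open import Data.Fin using (Fin; zero; suc)
open import Data.Fin.Subset using (Subset; _∈_; ∣_∣)
open import Data.Sum using (_⊎_)
open import Data.Product using (Σ; _×_)
open import Data.Empty using (⊥)
open import Relation.Nullary using (¬_)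
open import Relation.Binary.PropositionalEquality using (_≡_)
open import Function.Bundles using (_⇔_)

record Graph (n : ℕ) : Set₁ where
  field
    Adj   : Fin n → Fin n → Set
    sym    : ∀ x y → Adj x y → Adj y x
    irrefl : ∀ x → ¬ Adj x x
open Graph public

IsVertexCover : ∀ {n} → Graph n → Subset n → Set
IsVertexCover G S = ∀ x y → Adj G x y → (x ∈ S) ⊎ (y ∈ S)

HasVC : ∀ {n} → Graph n → ℕ → Set
HasVC {n} G k = Σ (Subset n) (λ S → IsVertexCover G S × ∣ S ∣ ≤ k)

InClosedNbhd : ∀ {n} → Graph n → Fin n → Fin n → Set
InClosedNbhd G v y = (y ≡ v) ⊎ Adj G v y

NewAdj : ∀ {n} → Graph n → Fin n → Subset n → Fin n → Set
NewAdj G v S y = (y ∈ S) ⊎ InClosedNbhd G v y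

-- G' : vertex set Fin (suc n); the new vertex u is 'zero',
-- old vertex x of G is 'suc x'.
addVertex : ∀ {n} → Graph n → Fin n → Subset n → Graph (suc n)
addVertex {n} G v S = record { Adj = A ; sym = s ; irrefl = i }
  where
  A : Fin (suc n) → Fin (suc n) → Set
  A zero    zero    = ⊥
  A zero    (suc y) = NewAdj G v S y
  A (suc x) zero    = NewAdj G v S x
  A (suc x) (suc y) = Adj G x y
  s : ∀ x y → A x y → A y x
  s zero    zero    ()
  s zero    (suc y) p = p
  s (suc x) zero    p = p
  s (suc x) (suc y) p = Graph.sym G x y p
  i : ∀ x → A x x → ⊥
  i zero    ()
  i (suc x) p = Graph.irrefl G x p

Equivalent : ∀ {n m} → Graph n → ℕ → Graph m → ℕ → Set
Equivalent G k G' k' = HasVC G k ⇔ HasVC G' k'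

module Submission where

open import Defs
open import Data.Nat using (ℕ; suc; _≤_; s≤s)
open import Data.Nat.Properties using (<-≤-trans; m<1+n⇒m≤n)
open import Data.Fin using (Fin; zero; suc; _≟_)
open import Data.Fin.Subset using (Subset; _∈_; _-_; ∣_∣; Side; inside; outside)
open import Data.Fin.Subset.Properties using (x∈p∧x≢y⇒x∈p-y; x∈p⇒∣p-x∣<∣p∣)
open import Data.Vec.Base using (_∷_; here; there)
open import Data.Sum.Base using (inj₁; inj₂; map)
open import Data.Product using (_,_)
open import Relation.Nullary using (yes; no)
open import Relation.Binary.PropositionalEquality using (refl)
open import Function.Base using (_∘_)
open import Function.Bundles using (mk⇔)

-- Let C' be a cover of G' with ∣ C' ∣ ≤ k + 1. If u ∈ C', then C' minus u
-- covers G. Otherwise all neighbours of u, in particular N[v], lie in C'; every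
-- edge of G at v then has its other endpoint in C', so C' minus v covers G.

module _ {n} (G : Graph n) where

  cover-minus-vertex : ∀ {C} v → IsVertexCover G C → (∀ y → Adj G v y → y ∈ C) →
                       IsVertexCover G (C - v)
  cover-minus-vertex v cov nbrs⊆C x y xy with x ≟ v | y ≟ v
  ... | yes refl | _        = inj₂ (x∈p∧x≢y⇒x∈p-y (nbrs⊆C y xy) λ { refl → irrefl G x xy })
  ... | no x≢v   | yes refl = inj₁ (x∈p∧x≢y⇒x∈p-y (nbrs⊆C x (sym G x y xy)) x≢v)
  ... | no x≢v   | no y≢v   =
    map (λ x∈C → x∈p∧x≢y⇒x∈p-y x∈C x≢v) (λ y∈C → x∈p∧x≢y⇒x∈p-y y∈C y≢v) (cov x y xy)

  closedNbhd⊆cover⇒hasVC : ∀ {C k} v → IsVertexCover G C →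
                           (∀ y → InClosedNbhd G v y → y ∈ C) → ∣ C ∣ ≤ suc k → HasVC G k
  closedNbhd⊆cover⇒hasVC {C} v cov N[v]⊆C ∣C∣≤1+k =
      C - v
    , cover-minus-vertex v cov (λ y → N[v]⊆C y ∘ inj₂)
    , m<1+n⇒m≤n (<-≤-trans (x∈p⇒∣p-x∣<∣p∣ (N[v]⊆C v (inj₁ refl))) ∣C∣≤1+k)

module _ {n} (G : Graph n) (v : Fin n) (S : Subset n) where

  addVertex-cover-inside : ∀ {C} → IsVertexCover G C → IsVertexCover (addVertex G v S) (inside ∷ C)
  addVertex-cover-inside cov zero    (suc y) _  = inj₁ here
  addVertex-cover-inside cov (suc x) zero    _  = inj₂ here
  addVertex-cover-inside cov (suc x) (suc y) xy = map there there (cov x y xy)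

  addVertex-cover-restrict : ∀ {b : Side} {C} → IsVertexCover (addVertex G v S) (b ∷ C) →
                             IsVertexCover G C
  addVertex-cover-restrict cov x y xy with cov (suc x) (suc y) xy
  ... | inj₁ (there x∈C) = inj₁ x∈C
  ... | inj₂ (there y∈C) = inj₂ y∈C

  addVertex-cover-outside : ∀ {C} → IsVertexCover (addVertex G v S) (outside ∷ C) →
                            ∀ y → NewAdj G v S y → y ∈ C
  addVertex-cover-outside cov y uy with cov zero (suc y) uy
  ... | inj₂ (there y∈C) = y∈C

lemma8 : ∀ {n} (G : Graph n) (k : ℕ) (v : Fin n) (S : Subset n) →
         Equivalent G k (addVertex G v S) (suc k)
lemma8 G k v S = mk⇔ extend shrink
  where
  extend : HasVC G k → HasVC (addVertex G v S) (suc k)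
  extend (C , cov , ∣C∣≤k) = inside ∷ C , addVertex-cover-inside G v S cov , s≤s ∣C∣≤k

  shrink : HasVC (addVertex G v S) (suc k) → HasVC G k
  shrink (inside ∷ C , cov , s≤s ∣C∣≤k) = C , addVertex-cover-restrict G v S cov , ∣C∣≤k
  shrink (outside ∷ C , cov , ∣C∣≤1+k) =
    closedNbhd⊆cover⇒hasVC G v (addVertex-cover-restrict G v S cov)
      (λ y → addVertex-cover-outside G v S cov y ∘ inj₂) ∣C∣≤1+k
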